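{- Let $(V,\mathcal{R},k)$ be a yes-instance of \textsc{$k$-BetweennessTour} and let $\mathcal{C}$ be a conflict packing of $(V,\mathcal{R})$. Then $|V(\mathcal{C})|\le 4k$.
   Context: A betweenness triplet on $\{a,b,c\}$ chooses one of its elements ($abc$ chooses $b$); $\mathcal{R}$ is dense if it contains exactly one triplet on each 3-subset of $V$. A triplet $abc$ is consistent with a linear ordering $\sigma$ of $V$ if $b$ lies between $a$ and $c$. \textsc{$k$-BetweennessTour}: given $V$, a dense set $\mathcal{R}$ of betweenness triplets on $V$ and an integer $k$, decide whether some linear ordering of $V$ is consistent with all but at most $k$ triplets of $\mathcal{R}$. A conflict is a 4-set $C\subseteq V$ such that no linear ordering of $C$ is consistent with all triplets of $\mathcal{R}[C]=\{t\in\mathcal{R}:V(t)\subseteq C\}$. A vertex $a$ of a conflict $\{a,b,c,d\}$ is a seed if $\{a,b,c,d\}$ remains a conflict whichever of the three betweenness triplets on $\{b,c,d\}$ is used in place of the one in $\mathcal{R}$. A conflict packing is a sequence of conflicts $C_1,\dots,C_l$ such that for each $2\le i\le l$, either $|C_i\cap\bigcup_{j<i}C_j|\le 2$, or $C_i$ has exactly one vertex not in $\bigcup_{j<i}C_j$ and that vertex is a seed of $C_i$; and which is maximal, i.e. cannot be extended by appending a further conflict satisfying this condition. $V(\mathcal{C})=\bigcup_iC_i$. -}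

module Defs where

open import Data.Nat using (ℕ; _<_; _≤_; _<ᵇ_)
open import Data.Bool using (Bool; true; false; _∧_; _∨_; not; if_then_else_)
open import Data.Fin using (Fin; toℕ; _≟_)
open import Data.Fin.Subset using (Subset; _∈_; _∉_; _∩_; _∪_; ∣_∣; ⋃; ⊥; _-_)
open import Data.Fin.Subset.Properties using (_∈?_)
open import Data.List using (List; []; _∷_; length; filterᵇ; concatMap; allFin)
open import Data.Product using (Σ; _×_; _,_)
open import Data.Sum using (_⊎_)
open import Data.Unit using (⊤)
open import Relation.Nullary using (¬_; does)
open import Relation.Binary.PropositionalEquality using (_≡_; _≢_)

-- A betweenness triplet on {a,b,c} is the choice of one of its elements (the middle).
-- A dense set R of triplets is encoded by a function `mid` giving, for every
-- 3-subset {a,b,c} (given as pairwise distinct a b c in any order), the chosen element.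
Distinct3 : {n : ℕ} → Fin n → Fin n → Fin n → Set
Distinct3 a b c = a ≢ b × b ≢ c × a ≢ c

record Dense (n : ℕ) : Set where
  field
    mid    : Fin n → Fin n → Fin n → Fin n
    mid-∈  : ∀ a b c → Distinct3 a b c → mid a b c ≡ a ⊎ mid a b c ≡ b ⊎ mid a b c ≡ c
    mid-swap₁ : ∀ a b c → Distinct3 a b c → mid a b c ≡ mid b a c
    mid-swap₂ : ∀ a b c → Distinct3 a b c → mid a b c ≡ mid a c b
open Dense public

MidFun : ℕ → Set
MidFun n = Fin n → Fin n → Fin n → Fin n

-- A linear ordering is given by an injective position map into ℕ
-- (σ orders x before y iff pos x < pos y).
Injective : {n : ℕ} → (Fin n → ℕ) → Set
Injective {n} pos = ∀ (x y : Fin n) → pos x ≡ pos y → x ≡ y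

InjectiveOn : {n : ℕ} → Subset n → (Fin n → ℕ) → Set
InjectiveOn {n} C pos = ∀ (x y : Fin n) → x ∈ C → y ∈ C → pos x ≡ pos y → x ≡ y

betweenᵇ : {n : ℕ} → (Fin n → ℕ) → Fin n → Fin n → Fin n → Bool
betweenᵇ pos x y z = ((pos x <ᵇ pos y) ∧ (pos y <ᵇ pos z)) ∨ ((pos z <ᵇ pos y) ∧ (pos y <ᵇ pos x))

consistentᵇ : {n : ℕ} → MidFun n → (Fin n → ℕ) → Fin n → Fin n → Fin n → Bool
consistentᵇ mid pos a b c =
  if does (mid a b c ≟ a) then betweenᵇ pos b a c
  else if does (mid a b c ≟ b) then betweenᵇ pos a b c
  else betweenᵇ pos a c b

-- all 3-subsets of V, listed as triples a < b < c
Triple : ℕ → Set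
Triple n = Fin n × Fin n × Fin n

triples : (n : ℕ) → List (Triple n)
triples n =
  concatMap (λ a → concatMap (λ b → concatMap (λ c →
     if (toℕ a <ᵇ toℕ b) ∧ (toℕ b <ᵇ toℕ c) then (a , b , c) ∷ [] else [])
     (allFin n)) (allFin n)) (allFin n)

violations : {n : ℕ} → MidFun n → (Fin n → ℕ) → ℕ
violations {n} mid pos =
  length (filterᵇ (λ { (a , b , c) → not (consistentᵇ mid pos a b c) }) (triples n))

YesInstance : {n : ℕ} → Dense n → ℕ → Set
YesInstance R k = Σ (_ → ℕ) λ pos → Injective pos × violations (mid R) pos ≤ k

Conflict : {n : ℕ} → MidFun n → Subset n → Set
Conflict {n} mid C =
  ∣ C ∣ ≡ 4 ×
  ¬ (Σ (Fin n → ℕ) λ pos → InjectiveOn C pos ×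
       (∀ a b c → a ∈ C → b ∈ C → c ∈ C → Distinct3 a b c →
          consistentᵇ mid pos a b c ≡ true))

replaceOn : {n : ℕ} → MidFun n → Subset n → Fin n → MidFun n
replaceOn mid T x a b c =
  if does (a ∈? T) ∧ does (b ∈? T) ∧ does (c ∈? T)
     ∧ not (does (a ≟ b)) ∧ not (does (b ≟ c)) ∧ not (does (a ≟ c))
  then x else mid a b c

-- a is a seed of the conflict C: C remains a conflict whichever of the three
-- triplets on C ∖ {a} is used in place of the one in R
Seed : {n : ℕ} → MidFun n → Subset n → Fin n → Set
Seed mid C a = a ∈ C × (∀ x → x ∈ C → x ≢ a → Conflict (replaceOn mid (C - a) x) C)

Appendable : {n : ℕ} → MidFun n → Subset n → Subset n → Set
Appendable mid U C =
  Conflict mid C ×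
  (∣ C ∩ U ∣ ≤ 2 ⊎
   Σ _ λ v → v ∈ C × v ∉ U × (∀ u → u ∈ C → u ∉ U → u ≡ v) × Seed mid C v)

PackingFrom : {n : ℕ} → MidFun n → Subset n → List (Subset n) → Set
PackingFrom mid U [] = ⊤
PackingFrom mid U (C ∷ Cs) = Appendable mid U C × PackingFrom mid (U ∪ C) Cs

ConflictPacking : {n : ℕ} → Dense n → List (Subset n) → Set
ConflictPacking {n} R Cs =
  PackingFrom (mid R) ⊥ Cs × (∀ (C : Subset n) → ¬ Appendable (mid R) (⋃ Cs) C)

-- Fix an ordering pos violating at most k triplets. Every conflict C of the packing contains a
-- triplet violated by pos that does not lie inside the union U of the earlier conflicts. If
-- |C ∩ U| ≤ 2, any violated triplet of C will do. Otherwise C has a single vertex v outside U and v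
-- is a seed: replacing the triplet on C - v by the one consistent with pos keeps C a conflict, so C
-- has a violated triplet through v, and that triplet belongs to R. These triplets are pairwise
-- distinct, so the packing has at most k conflicts and |V(𝒞)| ≤ 4k.

module Submission where

open import Defs
open import Data.Bool using (Bool; true; false; _∧_; if_then_else_)
import Data.Bool.Properties as Bool
open import Data.Fin using (Fin; zero; suc; toℕ; _≟_)
open import Data.Fin.Properties using (toℕ-injective; any?)
open import Data.Fin.Subset using (Subset; _∈_; _∉_; _⊆_; _∪_; ∣_∣; ⋃; _-_; inside; outside)
open import Data.Fin.Subset.Properties
  using (_∈?_; ∣⊥∣≡0; x∈p⇒∣p-x∣<∣p∣; x∈p∧x≢y⇒x∈p-y; x∈p∩q⁺; p⊆p∪q; q⊆p∪q)
open import Data.List using (List; []; _∷_; length; filter)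
open import Data.List.Membership.Propositional using () renaming (_∈_ to _∈ₗ_)
open import Data.List.Membership.Propositional.Properties using (∈-concatMap⁺; ∈-allFin)
open import Data.List.Relation.Binary.Permutation.Propositional using (↭-refl; prep; swap)
open import Data.List.Relation.Binary.Permutation.Propositional.Properties using (∈-resp-↭; All-resp-↭)
open import Data.List.Relation.Unary.All as All using (All; []; _∷_)
open import Data.List.Relation.Unary.All.Properties using (¬Any⇒All¬)
open import Data.List.Relation.Unary.Any as Any using (here; there)
open import Data.List.Relation.Unary.Unique.Propositional using (Unique)
open import Data.List.Relation.Unary.AllPairs using ([]; _∷_)
open import Data.Nat using (ℕ; suc; _<ᵇ_; _≤_; _<_; _+_; _*_; z≤n; s≤s)
open import Data.Nat.Properties
  using (≤-trans; ≤-reflexive; <⇒≱; <-irrefl; <-asym; <-cmp; <⇒<ᵇ; m≤n⇒m≤1+n; n≤1+n;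
         +-suc; *-suc; +-mono-≤; +-monoʳ-≤; *-monoʳ-≤; m≤m+n; ≤-pred; module ≤-Reasoning)
open import Data.Product using (∃; _×_; _,_; proj₁; proj₂)
open import Data.Sum using (inj₁; inj₂)
open import Data.Vec using ([]; _∷_; there)
open import Function.Base using (_∘_; id)
open import Function.Bundles using (Equivalence)
open import Relation.Binary.Definitions using (tri<; tri≈; tri>)
open import Relation.Binary.PropositionalEquality
  using (_≡_; _≢_; refl; sym; trans; cong; subst; ≢-sym; module ≡-Reasoning)
open import Relation.Nullary using (¬_; Dec; yes; no; contradiction)
open import Relation.Nullary.Decidable using (_×-dec_; ¬?; dec-true; dec-false; T?)
open import Relation.Unary using (Decidable)

∃₃ : ∀ {A : Set} → (A → A → A → Set) → Set
∃₃ P = ∃ λ a → ∃ λ b → ∃ λ c → P a b c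

∣p∪q∣≤∣p∣+∣q∣ : ∀ {n} (p q : Subset n) → ∣ p ∪ q ∣ ≤ ∣ p ∣ + ∣ q ∣
∣p∪q∣≤∣p∣+∣q∣ []            []            = z≤n
∣p∪q∣≤∣p∣+∣q∣ (outside ∷ p) (outside ∷ q) = ∣p∪q∣≤∣p∣+∣q∣ p q
∣p∪q∣≤∣p∣+∣q∣ (outside ∷ p) (inside  ∷ q) =
  ≤-trans (s≤s (∣p∪q∣≤∣p∣+∣q∣ p q)) (≤-reflexive (sym (+-suc ∣ p ∣ ∣ q ∣)))
∣p∪q∣≤∣p∣+∣q∣ (inside  ∷ p) (outside ∷ q) = s≤s (∣p∪q∣≤∣p∣+∣q∣ p q)
∣p∪q∣≤∣p∣+∣q∣ (inside  ∷ p) (inside  ∷ q) =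
  s≤s (≤-trans (∣p∪q∣≤∣p∣+∣q∣ p q) (+-monoʳ-≤ ∣ p ∣ (n≤1+n ∣ q ∣)))

∣⋃∣≤*length : ∀ {n k} (Cs : List (Subset n)) → All (λ C → ∣ C ∣ ≤ k) Cs → ∣ ⋃ Cs ∣ ≤ k * length Cs
∣⋃∣≤*length {n} []       []            = ≤-trans (≤-reflexive (∣⊥∣≡0 n)) z≤n
∣⋃∣≤*length {k = k} (C ∷ Cs) (∣C∣≤k ∷ ∣Cs∣≤k) = begin
  ∣ C ∪ ⋃ Cs ∣      ≤⟨ ∣p∪q∣≤∣p∣+∣q∣ C (⋃ Cs) ⟩
  ∣ C ∣ + ∣ ⋃ Cs ∣  ≤⟨ +-mono-≤ ∣C∣≤k (∣⋃∣≤*length Cs ∣Cs∣≤k) ⟩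
  k + k * length Cs ≡⟨ sym (*-suc k (length Cs)) ⟩
  k * length (C ∷ Cs) ∎
  where open ≤-Reasoning

All-∈p-x⁺ : ∀ {n} {p : Subset n} {x : Fin n} {xs} → All (_∈ p) xs → All (x ≢_) xs → All (_∈ p - x) xs
All-∈p-x⁺ xs⊆p x∉xs = All.zipWith (λ (y∈p , x≢y) → x∈p∧x≢y⇒x∈p-y y∈p (≢-sym x≢y)) (xs⊆p , x∉xs)

length≤∣p∣ : ∀ {n} {p : Subset n} {xs : List (Fin n)} → Unique xs → All (_∈ p) xs → length xs ≤ ∣ p ∣
length≤∣p∣ []            []            = z≤n
length≤∣p∣ (x≢xs ∷ xs!) (x∈p ∷ xs⊆p) =
  ≤-trans (s≤s (length≤∣p∣ xs! (All-∈p-x⁺ xs⊆p x≢xs))) (x∈p⇒∣p-x∣<∣p∣ x∈p)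

x∉p-x : ∀ {n} (p : Subset n) (x : Fin n) → x ∉ p - x
x∉p-x (s ∷ p) zero    ()
x∉p-x (s ∷ p) (suc x) (there x∈p-x) = x∉p-x p x x∈p-x

Distinct3⇒Unique : ∀ {n} {a b c : Fin n} → Distinct3 a b c → Unique (a ∷ b ∷ c ∷ [])
Distinct3⇒Unique (a≢b , b≢c , a≢c) = (a≢b ∷ a≢c ∷ []) ∷ (b≢c ∷ []) ∷ [] ∷ []

module _ {n} {p : Subset n} {a b c : Fin n} (abc! : Distinct3 a b c) (abc⊆p : All (_∈ p) (a ∷ b ∷ c ∷ [])) where

  3≤∣p∣ : 3 ≤ ∣ p ∣
  3≤∣p∣ = length≤∣p∣ (Distinct3⇒Unique abc!) abc⊆p

  ∣p∣≤3⇒∈ : ∣ p ∣ ≤ 3 → ∀ {y} → y ∈ p → y ∈ₗ a ∷ b ∷ c ∷ []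
  ∣p∣≤3⇒∈ ∣p∣≤3 {y} y∈p with Any.any? (y ≟_) (a ∷ b ∷ c ∷ [])
  ... | yes y∈abc = y∈abc
  ... | no  y∉abc =
    contradiction ∣p∣≤3 (<⇒≱ (length≤∣p∣ (¬Any⇒All¬ _ y∉abc ∷ Distinct3⇒Unique abc!) (y∈p ∷ abc⊆p)))

module _ {A : Set} {P Q : A → Set} (P? : Decidable P) (Q? : Decidable Q) (P⇒Q : ∀ {x} → P x → Q x) where

  length-filter-mono : ∀ xs → length (filter P? xs) ≤ length (filter Q? xs)
  length-filter-mono []       = z≤n
  length-filter-mono (x ∷ xs) with P? x | Q? x
  ... | yes _ | yes _  = s≤s (length-filter-mono xs)
  ... | yes p | no ¬q  = contradiction (P⇒Q p) ¬q
  ... | no _  | yes _  = m≤n⇒m≤1+n (length-filter-mono xs)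
  ... | no _  | no _   = length-filter-mono xs

  length-filter-mono-< : ∀ {x} xs → x ∈ₗ xs → ¬ P x → Q x → length (filter P? xs) < length (filter Q? xs)
  length-filter-mono-< (x ∷ xs) (here refl) ¬p q with P? x | Q? x
  ... | yes p | _     = contradiction p ¬p
  ... | no _  | yes _ = s≤s (length-filter-mono xs)
  ... | no _  | no ¬q = contradiction q ¬q
  length-filter-mono-< (y ∷ xs) (there x∈xs) ¬p q with P? y | Q? y
  ... | yes _ | yes _  = s≤s (length-filter-mono-< xs x∈xs ¬p q)
  ... | yes p | no ¬q  = contradiction (P⇒Q p) ¬q
  ... | no _  | yes _  = m≤n⇒m≤1+n (length-filter-mono-< xs x∈xs ¬p q)
  ... | no _  | no _   = length-filter-mono-< xs x∈xs ¬p q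

sorted∈triples : ∀ {n} {a b c : Fin n} → toℕ a < toℕ b → toℕ b < toℕ c → (a , b , c) ∈ₗ triples n
sorted∈triples {a = a} {b} {c} a<b b<c =
  ∈-concatMap⁺ _ (Any.map (λ { refl →
  ∈-concatMap⁺ _ (Any.map (λ { refl →
  ∈-concatMap⁺ _ (Any.map (λ { refl → selected }) (∈-allFin c)) }) (∈-allFin b)) }) (∈-allFin a))
  where
  selected : (a , b , c) ∈ₗ (if (toℕ a <ᵇ toℕ b) ∧ (toℕ b <ᵇ toℕ c) then (a , b , c) ∷ [] else [])
  selected rewrite Equivalence.to Bool.T-≡ (<⇒<ᵇ a<b) | Equivalence.to Bool.T-≡ (<⇒<ᵇ b<c) = here refl

module _ {n} (key : Fin n → ℕ) (key-injective : Injective key) (P : Fin n → Fin n → Fin n → Set)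
         (swap₁₂ : ∀ {a b c} → P a b c → P b a c) (swap₂₃ : ∀ {a b c} → P a b c → P a c b) where

  sort3 : ∀ {a b c} → Distinct3 a b c → P a b c →
          ∃₃ λ a′ b′ c′ → P a′ b′ c′ × key a′ < key b′ × key b′ < key c′
  sort3 {a} {b} {c} (a≢b , b≢c , a≢c) abc with <-cmp (key a) (key b)
  ... | tri≈ _ ka≡kb _ = contradiction (key-injective a b ka≡kb) a≢b
  ... | tri< a<b _ _ with <-cmp (key b) (key c)
  ...   | tri≈ _ kb≡kc _ = contradiction (key-injective b c kb≡kc) b≢c
  ...   | tri< b<c _ _ = a , b , c , abc , a<b , b<c
  ...   | tri> _ _ c<b with <-cmp (key a) (key c)
  ...     | tri≈ _ ka≡kc _ = contradiction (key-injective a c ka≡kc) a≢c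
  ...     | tri< a<c _ _ = a , c , b , swap₂₃ abc , a<c , c<b
  ...     | tri> _ _ c<a = c , a , b , swap₁₂ (swap₂₃ abc) , c<a , a<b
  sort3 {a} {b} {c} (a≢b , b≢c , a≢c) abc | tri> _ _ b<a with <-cmp (key a) (key c)
  ...   | tri≈ _ ka≡kc _ = contradiction (key-injective a c ka≡kc) a≢c
  ...   | tri< a<c _ _ = b , a , c , swap₁₂ abc , b<a , a<c
  ...   | tri> _ _ c<a with <-cmp (key b) (key c)
  ...     | tri≈ _ kb≡kc _ = contradiction (key-injective b c kb≡kc) b≢c
  ...     | tri< b<c _ _ = b , c , a , swap₂₃ (swap₁₂ abc) , b<c , c<a
  ...     | tri> _ _ c<b = c , b , a , swap₁₂ (swap₂₃ (swap₁₂ abc)) , c<b , b<a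

sort3-elements : ∀ {n} (key : Fin n → ℕ) → Injective key → ∀ {a b c} → Distinct3 a b c →
  ∃₃ λ a′ b′ c′ → All (_∈ₗ a ∷ b ∷ c ∷ []) (a′ ∷ b′ ∷ c′ ∷ []) × key a′ < key b′ × key b′ < key c′
sort3-elements key key-injective {a} {b} {c} abc! =
  sort3 key key-injective (λ a′ b′ c′ → All (_∈ₗ a ∷ b ∷ c ∷ []) (a′ ∷ b′ ∷ c′ ∷ []))
        (All-resp-↭ (swap _ _ ↭-refl)) (All-resp-↭ (prep _ (swap _ _ ↭-refl))) abc! (All.tabulate id)

-- consistentᵇ m pos a b c is definitionally consistentChoosingᵇ pos (m a b c) a b c.
consistentChoosingᵇ : ∀ {n} → (Fin n → ℕ) → Fin n → Fin n → Fin n → Fin n → Bool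
consistentChoosingᵇ pos x = consistentᵇ (λ _ _ _ → x) pos

module _ {n} (pos : Fin n → ℕ) where

  betweenᵇ-sym : ∀ x y z → betweenᵇ pos x y z ≡ betweenᵇ pos z y x
  betweenᵇ-sym x y z = Bool.∨-comm ((pos x <ᵇ pos y) ∧ (pos y <ᵇ pos z)) ((pos z <ᵇ pos y) ∧ (pos y <ᵇ pos x))

  betweenᵇ-intro : ∀ {x y z} → pos x < pos y → pos y < pos z → betweenᵇ pos x y z ≡ true
  betweenᵇ-intro x<y y<z
    rewrite Equivalence.to Bool.T-≡ (<⇒<ᵇ x<y) | Equivalence.to Bool.T-≡ (<⇒<ᵇ y<z) = refl

  betweenᵇ-middle : ∀ {p x q y z} → y ∈ₗ p ∷ x ∷ q ∷ [] → z ∈ₗ p ∷ x ∷ q ∷ [] →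
                    pos y < pos x → pos x < pos z → betweenᵇ pos p x q ≡ true
  betweenᵇ-middle (there (here refl)) _ y<x _ = contradiction y<x (<-irrefl refl)
  betweenᵇ-middle _ (there (here refl)) _ x<z = contradiction x<z (<-irrefl refl)
  betweenᵇ-middle (here refl) (there (there (here refl))) p<x x<q = betweenᵇ-intro p<x x<q
  betweenᵇ-middle {p} {x} {q} (there (there (here refl))) (here refl) q<x x<p =
    trans (betweenᵇ-sym p x q) (betweenᵇ-intro q<x x<p)
  betweenᵇ-middle (here refl) (here refl) y<x x<z = contradiction x<z (<-asym y<x)
  betweenᵇ-middle (there (there (here refl))) (there (there (here refl))) y<x x<z =
    contradiction x<z (<-asym y<x)

  consistentChoosing-swap₁₂ : ∀ {x a b c} → Distinct3 a b c → x ∈ₗ a ∷ b ∷ c ∷ [] →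
                              consistentChoosingᵇ pos x a b c ≡ consistentChoosingᵇ pos x b a c
  consistentChoosing-swap₁₂ {x} {b = b} (x≢b , _ , _) (here refl)
    rewrite dec-true (x ≟ x) refl | dec-false (x ≟ b) x≢b = refl
  consistentChoosing-swap₁₂ {x} {a} (a≢x , _ , _) (there (here refl))
    rewrite dec-true (x ≟ x) refl | dec-false (x ≟ a) (≢-sym a≢x) = refl
  consistentChoosing-swap₁₂ {x} {a} {b} (_ , b≢x , a≢x) (there (there (here refl)))
    rewrite dec-false (x ≟ a) (≢-sym a≢x) | dec-false (x ≟ b) (≢-sym b≢x) = betweenᵇ-sym a x b

  consistentChoosing-swap₂₃ : ∀ {x a b c} → Distinct3 a b c → x ∈ₗ a ∷ b ∷ c ∷ [] →
                              consistentChoosingᵇ pos x a b c ≡ consistentChoosingᵇ pos x a c b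
  consistentChoosing-swap₂₃ {x} {b = b} {c} _ (here refl)
    rewrite dec-true (x ≟ x) refl = betweenᵇ-sym b x c
  consistentChoosing-swap₂₃ {x} {a} {c = c} (a≢x , x≢c , _) (there (here refl))
    rewrite dec-true (x ≟ x) refl | dec-false (x ≟ a) (≢-sym a≢x) | dec-false (x ≟ c) x≢c = refl
  consistentChoosing-swap₂₃ {x} {a} {b} (_ , b≢x , a≢x) (there (there (here refl)))
    rewrite dec-true (x ≟ x) refl | dec-false (x ≟ a) (≢-sym a≢x) | dec-false (x ≟ b) (≢-sym b≢x) = refl

  consistentChoosing-middle : ∀ {a b c y x z} → Distinct3 a b c → All (_∈ₗ a ∷ b ∷ c ∷ []) (y ∷ x ∷ z ∷ []) →
                              pos y < pos x → pos x < pos z → consistentChoosingᵇ pos x a b c ≡ true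
  consistentChoosing-middle {b = b} {x = x} _ (y∈ ∷ here refl ∷ z∈ ∷ []) y<x x<z
    rewrite dec-true (x ≟ x) refl =
    betweenᵇ-middle (∈-resp-↭ (swap x b ↭-refl) y∈) (∈-resp-↭ (swap x b ↭-refl) z∈) y<x x<z
  consistentChoosing-middle {a} {x = x} (a≢x , _ , _) (y∈ ∷ there (here refl) ∷ z∈ ∷ []) y<x x<z
    rewrite dec-false (x ≟ a) (≢-sym a≢x) | dec-true (x ≟ x) refl = betweenᵇ-middle y∈ z∈ y<x x<z
  consistentChoosing-middle {a} {b} {x = x} (_ , b≢x , a≢x) (y∈ ∷ there (there (here refl)) ∷ z∈ ∷ []) y<x x<z
    rewrite dec-false (x ≟ a) (≢-sym a≢x) | dec-false (x ≟ b) (≢-sym b≢x) =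
    betweenᵇ-middle (∈-resp-↭ (prep a (swap b x ↭-refl)) y∈) (∈-resp-↭ (prep a (swap b x ↭-refl)) z∈) y<x x<z

Distinct3-swap₁₂ : ∀ {n} {a b c : Fin n} → Distinct3 a b c → Distinct3 b a c
Distinct3-swap₁₂ (a≢b , b≢c , a≢c) = ≢-sym a≢b , a≢c , b≢c

Distinct3-swap₂₃ : ∀ {n} {a b c : Fin n} → Distinct3 a b c → Distinct3 a c b
Distinct3-swap₂₃ (a≢b , b≢c , a≢c) = a≢c , ≢-sym b≢c , a≢b

Violation : ∀ {n} → MidFun n → (Fin n → ℕ) → Subset n → Fin n → Fin n → Fin n → Set
Violation m pos C a b c = All (_∈ C) (a ∷ b ∷ c ∷ []) × Distinct3 a b c × consistentᵇ m pos a b c ≡ false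

violation? : ∀ {n} (m : MidFun n) pos C a b c → Dec (Violation m pos C a b c)
violation? m pos C a b c =
  All.all? (_∈? C) (a ∷ b ∷ c ∷ [])
  ×-dec (¬? (a ≟ b) ×-dec ¬? (b ≟ c) ×-dec ¬? (a ≟ c))
  ×-dec (consistentᵇ m pos a b c Bool.≟ false)

conflict⇒violation : ∀ {n} (m : MidFun n) {pos C} → Injective pos → Conflict m C → ∃₃ (Violation m pos C)
conflict⇒violation m {pos} {C} pos-injective (_ , noConsistentOrdering)
  with any? (λ a → any? (λ b → any? (λ c → violation? m pos C a b c)))
... | yes violation  = violation
... | no ¬violation = contradiction (pos , (λ x y _ _ → pos-injective x y) , consistent) noConsistentOrdering
  where
  consistent : ∀ a b c → a ∈ C → b ∈ C → c ∈ C → Distinct3 a b c → consistentᵇ m pos a b c ≡ true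
  consistent a b c a∈C b∈C c∈C abc! =
    Bool.¬-not λ inconsistent → ¬violation (a , b , c , (a∈C ∷ b∈C ∷ c∈C ∷ []) , abc! , inconsistent)

module _ {n} (m : MidFun n) {T : Subset n} {x a b c : Fin n} where

  replaceOn-inside : All (_∈ T) (a ∷ b ∷ c ∷ []) → Distinct3 a b c → replaceOn m T x a b c ≡ x
  replaceOn-inside (a∈T ∷ b∈T ∷ c∈T ∷ []) (a≢b , b≢c , a≢c)
    rewrite dec-true (a ∈? T) a∈T | dec-true (b ∈? T) b∈T | dec-true (c ∈? T) c∈T
          | dec-false (a ≟ b) a≢b | dec-false (b ≟ c) b≢c | dec-false (a ≟ c) a≢c = refl

  replaceOn-outside : ¬ All (_∈ T) (a ∷ b ∷ c ∷ []) → replaceOn m T x a b c ≡ m a b c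
  replaceOn-outside abc⊈T with a ∈? T | b ∈? T | c ∈? T
  ... | yes a∈T | yes b∈T | yes c∈T = contradiction (a∈T ∷ b∈T ∷ c∈T ∷ []) abc⊈T
  ... | yes _   | yes _   | no _    = refl
  ... | yes _   | no _    | _       = refl
  ... | no _    | _       | _       = refl

replaceOn-middle-consistent : ∀ {n} (m : MidFun n) (pos : Fin n → ℕ) {T : Subset n} {y x z a b c} →
  ∣ T ∣ ≤ 3 → All (_∈ T) (y ∷ x ∷ z ∷ []) → pos y < pos x → pos x < pos z →
  All (_∈ T) (a ∷ b ∷ c ∷ []) → Distinct3 a b c → consistentᵇ (replaceOn m T x) pos a b c ≡ true
replaceOn-middle-consistent m pos ∣T∣≤3 yxz⊆T y<x x<z abc⊆T abc! =
  trans (cong (λ w → consistentChoosingᵇ pos w _ _ _) (replaceOn-inside m abc⊆T abc!))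
        (consistentChoosing-middle pos abc! (All.map (∣p∣≤3⇒∈ abc! abc⊆T ∣T∣≤3) yxz⊆T) y<x x<z)

-- The triplet on C - v is now consistent with pos, so a violated triplet of C must contain v,
-- and there the replacement leaves m unchanged.
replaceOn-middle-conflict⇒violation∋ : ∀ {n} (m : MidFun n) {pos : Fin n → ℕ} → Injective pos →
  ∀ {C : Subset n} {v y x z} → ∣ C - v ∣ ≤ 3 → All (_∈ C - v) (y ∷ x ∷ z ∷ []) → pos y < pos x → pos x < pos z →
  Conflict (replaceOn m (C - v) x) C → ∃₃ λ a b c → Violation m pos C a b c × v ∈ₗ a ∷ b ∷ c ∷ []
replaceOn-middle-conflict⇒violation∋ m {pos} pos-injective {C} {v} {x = x} ∣C-v∣≤3 yxz⊆C-v y<x x<z conflict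
  with conflict⇒violation (replaceOn m (C - v) x) pos-injective conflict
... | a , b , c , abc⊆C , abc! , inconsistent with Any.any? (v ≟_) (a ∷ b ∷ c ∷ [])
...   | yes v∈abc =
  a , b , c , (abc⊆C , abc! , trans (cong (λ w → consistentChoosingᵇ pos w a b c) unchanged) inconsistent) , v∈abc
  where
  unchanged : m a b c ≡ replaceOn m (C - v) x a b c
  unchanged = sym (replaceOn-outside m (λ abc⊆C-v → x∉p-x C v (All.lookup abc⊆C-v v∈abc)))
...   | no  v∉abc = contradiction (trans (sym consistent) inconsistent) λ ()
  where
  consistent : consistentᵇ (replaceOn m (C - v) x) pos a b c ≡ true
  consistent = replaceOn-middle-consistent m pos ∣C-v∣≤3 yxz⊆C-v y<x x<z
                 (All-∈p-x⁺ abc⊆C (¬Any⇒All¬ _ v∉abc)) abc!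

module _ {n} (R : Dense n) (pos : Fin n → ℕ) where

  mid∈ : ∀ {a b c} → Distinct3 a b c → mid R a b c ∈ₗ a ∷ b ∷ c ∷ []
  mid∈ {a} {b} {c} abc! with mid-∈ R a b c abc!
  ... | inj₁ mid≡a        = here mid≡a
  ... | inj₂ (inj₁ mid≡b) = there (here mid≡b)
  ... | inj₂ (inj₂ mid≡c) = there (there (here mid≡c))

  consistentᵇ-swap₁₂ : ∀ {a b c} → Distinct3 a b c →
                       consistentᵇ (mid R) pos a b c ≡ consistentᵇ (mid R) pos b a c
  consistentᵇ-swap₁₂ {a} {b} {c} abc! = begin
    consistentChoosingᵇ pos (mid R a b c) a b c ≡⟨ consistentChoosing-swap₁₂ pos abc! (mid∈ abc!) ⟩
    consistentChoosingᵇ pos (mid R a b c) b a c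
      ≡⟨ cong (λ x → consistentChoosingᵇ pos x b a c) (mid-swap₁ R a b c abc!) ⟩
    consistentChoosingᵇ pos (mid R b a c) b a c ∎
    where open ≡-Reasoning

  consistentᵇ-swap₂₃ : ∀ {a b c} → Distinct3 a b c →
                       consistentᵇ (mid R) pos a b c ≡ consistentᵇ (mid R) pos a c b
  consistentᵇ-swap₂₃ {a} {b} {c} abc! = begin
    consistentChoosingᵇ pos (mid R a b c) a b c ≡⟨ consistentChoosing-swap₂₃ pos abc! (mid∈ abc!) ⟩
    consistentChoosingᵇ pos (mid R a b c) a c b
      ≡⟨ cong (λ x → consistentChoosingᵇ pos x a c b) (mid-swap₂ R a b c abc!) ⟩
    consistentChoosingᵇ pos (mid R a c b) a c b ∎
    where open ≡-Reasoning

  NewViolation : Subset n → Subset n → Fin n → Fin n → Fin n → Set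
  NewViolation U C a b c = Violation (mid R) pos C a b c × ¬ All (_∈ U) (a ∷ b ∷ c ∷ [])

  newViolation-swap₁₂ : ∀ {U C a b c} → NewViolation U C a b c → NewViolation U C b a c
  newViolation-swap₁₂ {a = a} {b} ((abc⊆C , abc! , inconsistent) , abc⊈U) =
    ( All-resp-↭ (swap a b ↭-refl) abc⊆C
    , Distinct3-swap₁₂ abc!
    , trans (sym (consistentᵇ-swap₁₂ abc!)) inconsistent
    ) , abc⊈U ∘ All-resp-↭ (swap b a ↭-refl)

  newViolation-swap₂₃ : ∀ {U C a b c} → NewViolation U C a b c → NewViolation U C a c b
  newViolation-swap₂₃ {a = a} {b} {c} ((abc⊆C , abc! , inconsistent) , abc⊈U) =
    ( All-resp-↭ (prep a (swap b c ↭-refl)) abc⊆C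
    , Distinct3-swap₂₃ abc!
    , trans (sym (consistentᵇ-swap₂₃ abc!)) inconsistent
    ) , abc⊈U ∘ All-resp-↭ (prep a (swap c b ↭-refl))

module _ {n} (m : MidFun n) (pos : Fin n → ℕ) where

  ViolatedInside : Subset n → Triple n → Set
  ViolatedInside U (a , b , c) = consistentᵇ m pos a b c ≡ false × All (_∈ U) (a ∷ b ∷ c ∷ [])

  violatedInside? : ∀ U → Decidable (ViolatedInside U)
  violatedInside? U (a , b , c) = (consistentᵇ m pos a b c Bool.≟ false) ×-dec All.all? (_∈? U) (a ∷ b ∷ c ∷ [])

  violationsInside : Subset n → ℕ
  violationsInside U = length (filter (violatedInside? U) (triples n))

  violationsInside≤violations : ∀ U → violationsInside U ≤ violations m pos
  violationsInside≤violations U =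
    length-filter-mono (violatedInside? U) (T? ∘ _) (Equivalence.from Bool.T-not-≡ ∘ proj₁) (triples n)

  violationsInside-< : ∀ {U U′ a b c} → U ⊆ U′ → toℕ a < toℕ b → toℕ b < toℕ c →
    consistentᵇ m pos a b c ≡ false → All (_∈ U′) (a ∷ b ∷ c ∷ []) → ¬ All (_∈ U) (a ∷ b ∷ c ∷ []) →
    violationsInside U < violationsInside U′
  violationsInside-< {U} {U′} U⊆U′ a<b b<c inconsistent abc⊆U′ abc⊈U =
    length-filter-mono-< (violatedInside? U) (violatedInside? U′) (λ (inc , xs⊆U) → inc , All.map U⊆U′ xs⊆U)
      (triples n) (sorted∈triples a<b b<c) (abc⊈U ∘ proj₂) (inconsistent , abc⊆U′)

module _ {n} (R : Dense n) {pos : Fin n → ℕ} (pos-injective : Injective pos) where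

  conflict⇒violation∋seed : ∀ {C v} → Conflict (mid R) C → Seed (mid R) C v →
                            ∃₃ λ a b c → Violation (mid R) pos C a b c × v ∈ₗ a ∷ b ∷ c ∷ []
  conflict⇒violation∋seed {C} {v} conflict@(∣C∣≡4 , _) (v∈C , seed)
    with conflict⇒violation (mid R) pos-injective conflict
  ... | a , b , c , violation@(abc⊆C , abc! , _)
    with Any.any? (v ≟_) (a ∷ b ∷ c ∷ []) | sort3-elements pos pos-injective abc!
  ...   | yes v∈abc | _ = a , b , c , violation , v∈abc
  ...   | no  v∉abc | y , x , z , yxz⊆abc@(_ ∷ x∈abc ∷ _ ∷ []) , y<x , x<z =
    replaceOn-middle-conflict⇒violation∋ (mid R) pos-injective
      ∣C-v∣≤3 (All.map (All.lookup abc⊆C-v) yxz⊆abc) y<x x<z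
      (seed x (All.lookup abc⊆C x∈abc) (≢-sym (All.lookup v≢abc x∈abc)))
    where
    v≢abc = ¬Any⇒All¬ _ v∉abc
    abc⊆C-v = All-∈p-x⁺ abc⊆C v≢abc
    ∣C-v∣≤3 : ∣ C - v ∣ ≤ 3
    ∣C-v∣≤3 = ≤-pred (subst (∣ C - v ∣ <_) ∣C∣≡4 (x∈p⇒∣p-x∣<∣p∣ v∈C))

  appendable⇒newViolation : ∀ {U C} → Appendable (mid R) U C → ∃₃ (NewViolation R pos U C)
  appendable⇒newViolation (conflict , inj₁ ∣C∩U∣≤2)
    with conflict⇒violation (mid R) pos-injective conflict
  ... | a , b , c , violation@(abc⊆C , abc! , _) =
    a , b , c , violation , λ abc⊆U → <⇒≱ (3≤∣p∣ abc! (All.zipWith x∈p∩q⁺ (abc⊆C , abc⊆U))) ∣C∩U∣≤2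
  appendable⇒newViolation (conflict , inj₂ (v , _ , v∉U , _ , seed))
    with conflict⇒violation∋seed conflict seed
  ... | a , b , c , violation , v∈abc = a , b , c , violation , λ abc⊆U → v∉U (All.lookup abc⊆U v∈abc)

  -- triples n lists every 3-set once, sorted by toℕ.
  appendable⇒violationsInside< : ∀ {U C} → Appendable (mid R) U C →
    violationsInside (mid R) pos U < violationsInside (mid R) pos (U ∪ C)
  appendable⇒violationsInside< {U} {C} appendable with appendable⇒newViolation appendable
  ... | a , b , c , new@((_ , abc! , _) , _)
    with sort3 toℕ (λ _ _ → toℕ-injective) (NewViolation R pos U C)
               (newViolation-swap₁₂ R pos) (newViolation-swap₂₃ R pos) abc! new
  ... | _ , _ , _ , ((abc⊆C , _ , inconsistent) , abc⊈U) , a<b , b<c =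
    violationsInside-< (mid R) pos (p⊆p∪q C) a<b b<c inconsistent (All.map (q⊆p∪q U C) abc⊆C) abc⊈U

  packing-length : ∀ {U Cs} → PackingFrom (mid R) U Cs →
    length Cs + violationsInside (mid R) pos U ≤ violations (mid R) pos
  packing-length {U} {[]}     _                    = violationsInside≤violations (mid R) pos U
  packing-length {U} {C ∷ Cs} (appendable , packing) = begin
    suc (length Cs) + violationsInside (mid R) pos U
      ≡⟨ sym (+-suc (length Cs) _) ⟩
    length Cs + suc (violationsInside (mid R) pos U)
      ≤⟨ +-monoʳ-≤ (length Cs) (appendable⇒violationsInside< appendable) ⟩
    length Cs + violationsInside (mid R) pos (U ∪ C)
      ≤⟨ packing-length packing ⟩
    violations (mid R) pos
      ∎
    where open ≤-Reasoning

packing-sizes : ∀ {n} {m : MidFun n} {U} Cs → PackingFrom m U Cs → All (λ C → ∣ C ∣ ≤ 4) Cs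
packing-sizes []       _                                  = []
packing-sizes (C ∷ Cs) (((∣C∣≡4 , _) , _) , packing) = ≤-reflexive ∣C∣≡4 ∷ packing-sizes Cs packing

lemma12 : (n : ℕ) (R : Dense n) (k : ℕ) (Cs : List (Subset n)) →
    YesInstance R k → ConflictPacking R Cs → ∣ ⋃ Cs ∣ ≤ 4 * k
lemma12 n R k Cs (pos , pos-injective , violations≤k) (packing , _) = begin
  ∣ ⋃ Cs ∣                 ≤⟨ ∣⋃∣≤*length Cs (packing-sizes Cs packing) ⟩
  4 * length Cs            ≤⟨ *-monoʳ-≤ 4 length≤k ⟩
  4 * k                    ∎
  where
  open ≤-Reasoning
  length≤k : length Cs ≤ k
  length≤k = ≤-trans (m≤m+n (length Cs) _) (≤-trans (packing-length R pos-injective packing) violations≤k)
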